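{- Let $P$ be a finite $\Gamma$-colored $d$-complete poset with top tree $T$ and assume $\Gamma$ is simply laced. Then $T=Ch(P)$.
   Context: Dynkin diagram $\Gamma$: finite set with integers $\theta_{ab}$, $\theta_{aa}=2$, $\theta_{ab}\le0$ ($a\ne b$), $\theta_{ab}=0\iff\theta_{ba}=0$; $a\sim b$ if $a\ne b$ and $\theta_{ab}<0$; simply laced: all $\theta_{ab}\in\{ -1,0,2\}$. $\Gamma$-colored poset: poset with surjective $\kappa:P\to\Gamma$. Consecutive elements of color $a$: $x<y$ of color $a$, no color-$a$ element in $(x,y)$. $U(x,P)=\{y>x:\kappa(y)\sim\kappa(x)\}$. $\Gamma$-colored $d$-complete: locally finite with (EC) equal colors comparable; (NA) neighbors (one covers the other) have adjacent colors; (AC) adjacent colors comparable; (ICE2) consecutive $x<y$ of color $a$ have $\sum_{z\in(x,y)}-\theta_{\kappa(z),a}=2$; (UCB1) for maximal $x$ of color $a$, $U(x,P)$ finite and $\sum_{y\in U(x,P)}-\theta_{\kappa(y),a}\le1$. The top tree $T$ of finite $P$ is the set of elements maximal among elements of their color. $Ch(P)$ is the set of $x\in P$ whose principal filter $\{y\in P:y\ge x\}$ is a chain. -}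

module Defs where

open import Data.Nat using (ℕ)
open import Data.Fin using (Fin)
open import Data.Fin.Properties using (_≟_)
open import Data.Integer using (ℤ; +_; -_; _+_; _≤_; _<_; 0ℤ; -1ℤ)
open import Data.List using (List; map; filter; foldr)
open import Data.List.Base using ()
open import Data.Fin.Base using ()
open import Data.Product using (Σ; _×_; _,_; ∃)
open import Data.Sum using (_⊎_)
open import Relation.Binary.PropositionalEquality using (_≡_; _≢_)
open import Relation.Binary.Structures using (IsDecPartialOrder)
open import Relation.Nullary using (¬_; Dec; yes; no)
open import Relation.Nullary.Decidable using (_×-dec_; ¬?)
open import Data.List using (allFin)

record Dynkin (m : ℕ) : Set where
  field
    θ        : Fin m → Fin m → ℤ
    θ-diag   : ∀ a → θ a a ≡ + 2
    θ-off    : ∀ a b → a ≢ b → θ a b ≤ 0ℤ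
    θ-zero   : ∀ a b → θ a b ≡ 0ℤ → θ b a ≡ 0ℤ   -- with a,b swapped gives the iff

  _∼_ : Fin m → Fin m → Set
  a ∼ b = (a ≢ b) × (θ a b < 0ℤ)

SimplyLaced : ∀ {m} → Dynkin m → Set
SimplyLaced {m} Γ = ∀ (a b : Fin m) →
  (Dynkin.θ Γ a b ≡ -1ℤ) ⊎ (Dynkin.θ Γ a b ≡ 0ℤ) ⊎ (Dynkin.θ Γ a b ≡ + 2)

sumℤ : List ℤ → ℤ
sumℤ = foldr _+_ 0ℤ

record ColoredPoset {m : ℕ} (Γ : Dynkin m) : Set₁ where
  field
    n       : ℕ
    _≼_     : Fin n → Fin n → Set
    isDPO   : IsDecPartialOrder _≡_ _≼_
    κ       : Fin n → Fin m
    κ-surj  : ∀ (a : Fin m) → ∃ λ x → κ x ≡ a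

  open Dynkin Γ

  _≼?_ : ∀ x y → Dec (x ≼ y)
  _≼?_ = IsDecPartialOrder._≤?_ isDPO

  _≺_ : Fin n → Fin n → Set
  x ≺ y = (x ≼ y) × (x ≢ y)

  _≺?_ : ∀ x y → Dec (x ≺ y)
  x ≺? y = (x ≼? y) ×-dec ¬? (x ≟ y)

  Comparable : Fin n → Fin n → Set
  Comparable x y = (x ≼ y) ⊎ (y ≼ x)

  _⋖_ : Fin n → Fin n → Set
  x ⋖ y = (x ≺ y) × (∀ z → x ≺ z → ¬ (z ≺ y))

  Consecutive : Fin m → Fin n → Fin n → Set
  Consecutive a x y = (κ x ≡ a) × (κ y ≡ a) × (x ≺ y)
                      × (∀ z → x ≺ z → z ≺ y → κ z ≢ a)

  intervalSum : Fin m → Fin n → Fin n → ℤ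
  intervalSum a x y =
    sumℤ (map (λ z → - θ (κ z) a)
              (filter (λ z → (x ≺? z) ×-dec (z ≺? y)) (allFin n)))

  -- Σ_{y ∈ U(x,P)} -θ(κ y, a),  U(x,P) = {y > x : κ y ∼ κ x}
  USum : Fin m → Fin n → ℤ
  USum a x =
    sumℤ (map (λ y → - θ (κ y) a)
              (filter (λ y → (x ≺? y) ×-dec adj? (κ y) (κ x)) (allFin n)))
    where
    adj? : ∀ b c → Dec (b ∼ c)
    adj? b c = ¬? (b ≟ c) ×-dec (θ b c Data.Integer.<? 0ℤ)

  MaxInColor : Fin n → Set
  MaxInColor x = ∀ y → κ y ≡ κ x → ¬ (x ≺ y)

  InTopTree : Fin n → Set
  InTopTree = MaxInColor

  InCh : Fin n → Set
  InCh x = ∀ y z → x ≼ y → x ≼ z → Comparable y z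

  -- Γ-colored d-complete (local finiteness is automatic for a finite poset)
  record IsDComplete : Set where
    field
      EC   : ∀ x y → κ x ≡ κ y → Comparable x y
      NA   : ∀ x y → x ⋖ y → κ x ∼ κ y
      AC   : ∀ x y → κ x ∼ κ y → Comparable x y
      ICE2 : ∀ a x y → Consecutive a x y → intervalSum a x y ≡ + 2
      UCB1 : ∀ a x → κ x ≡ a → MaxInColor x → USum a x ≤ + 1

-- Simple lacing together with UCB1 says that an element x maximal in its color
-- has at most one element of adjacent color above it. Since upper covers have
-- adjacent colors (NA), such an x has a unique upper cover, which again lies in
-- the top tree; climbing from cover to cover shows that the filter of x is a chain.
-- Conversely, if the filter of x is a chain but x is not in the top tree, take u ≥ x
-- maximal outside the top tree and v the next element of its color. The interval
-- (u, v) then consists of the upper cover of u alone, whose color is adjacent to that of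
-- u, so the ICE2 sum over it is 1 instead of 2.
module Submission where

open import Defs
open import Data.Nat using (ℕ)
open import Data.Fin using (Fin)
open import Function.Bundles using (_⇔_)

import Data.Nat as ℕ
open import Data.Fin.Properties using (_≟_; any?)
open import Data.Fin.Induction using (po-wellFounded; po-noetherian)
open import Data.Integer using (ℤ; +_; -_; 0ℤ)
import Data.Integer as ℤ
import Data.Integer.Properties as ℤ
open import Data.List using (List; []; _∷_; map; filter; allFin; length)
open import Data.List.Relation.Unary.All as All using (All; []; _∷_)
open import Data.List.Relation.Unary.All.Properties using (all-filter)
open import Data.List.Relation.Unary.AllPairs using ([]; _∷_)
open import Data.List.Relation.Unary.Unique.Propositional using (Unique)
import Data.List.Relation.Unary.Unique.Propositional.Properties as Unique
open import Data.List.Membership.Propositional using (_∈_)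
open import Data.List.Membership.Propositional.Properties using (∈-filter⁺; ∈-allFin)
open import Data.List.Relation.Unary.Any using (here)
open import Data.Product using (_×_; _,_; ∃; proj₁; proj₂)
open import Data.Sum using (_⊎_; inj₁; inj₂)
open import Data.Empty using (⊥; ⊥-elim)
open import Relation.Binary.PropositionalEquality using (_≡_; refl; sym; trans; subst)
open import Relation.Binary.Structures using (IsDecPartialOrder)
open import Relation.Binary.Core using (Rel)
import Relation.Binary.Definitions as B
open import Relation.Unary using (Pred; Decidable)
open import Relation.Nullary using (¬_; yes; no; contradiction)
open import Relation.Nullary.Decidable using (_×-dec_)
open import Induction.WellFounded using (WellFounded; Acc; acc)
import Induction.WellFounded as WF
open import Function.Bundles using (mk⇔)

module _ {A : Set} where

  sumℤ-map-ones : (f : A → ℤ) {l : List A} → All (λ y → f y ≡ + 1) l →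
    sumℤ (map f l) ≡ + length l
  sumℤ-map-ones f []       = refl
  sumℤ-map-ones f (p ∷ ps) rewrite p | sumℤ-map-ones f ps = refl

  length≤1⇒∈-unique : ∀ {l : List A} {y z} → length l ℕ.≤ 1 → y ∈ l → z ∈ l → y ≡ z
  length≤1⇒∈-unique {_ ∷ []}    _ (here refl) (here refl) = refl
  length≤1⇒∈-unique {_ ∷ _ ∷ _} (ℕ.s≤s ()) _ _

  module _ {p} {P : Pred A p} (P? : Decidable P) (f : A → ℤ) where

    filter-sum≤1⇒unique : (∀ {y} → P y → f y ≡ + 1) → ∀ {l y z} →
      sumℤ (map f (filter P? l)) ℤ.≤ + 1 → y ∈ l → z ∈ l → P y → P z → y ≡ z
    filter-sum≤1⇒unique f≡1 {l} sum≤1 y∈l z∈l Py Pz =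
      length≤1⇒∈-unique (ℤ.drop‿+≤+ length≤1) (∈-filter⁺ P? y∈l Py) (∈-filter⁺ P? z∈l Pz)
      where
      length≤1 : + length (filter P? l) ℤ.≤ + 1
      length≤1 = subst (ℤ._≤ + 1)
        (sumℤ-map-ones f (All.map f≡1 (all-filter P? l))) sum≤1

    filter-unique-sum : ∀ {l} e → Unique l → (∀ {y} → P y → y ≡ e) →
      let s = sumℤ (map f (filter P? l)) in (s ≡ 0ℤ) ⊎ (s ≡ f e)
    filter-unique-sum {l} e unique P⇒≡e =
      sum-subsingleton (Unique.filter⁺ P? unique) (All.map P⇒≡e (all-filter P? l))
      where
      sum-subsingleton : ∀ {k} → Unique k → All (_≡ e) k →
        (sumℤ (map f k) ≡ 0ℤ) ⊎ (sumℤ (map f k) ≡ f e)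
      sum-subsingleton []              []                = inj₁ refl
      sum-subsingleton (_ ∷ [])        (refl ∷ [])       = inj₂ (ℤ.+-identityʳ (f e))
      sum-subsingleton ((y≢z ∷ _) ∷ _) (refl ∷ refl ∷ _) = contradiction refl y≢z

module _ {n r} {_<_ : Rel (Fin n) r} (_<?_ : B.Decidable _<_) (wf : WellFounded _<_) where

  minimal : ∀ {q} {Q : Pred (Fin n) q} → Decidable Q → ∀ {w} → Q w →
    ∃ λ m → Q m × (∀ z → Q z → ¬ z < m)
  minimal {Q = Q} Q? {w} Qw = go w (wf w) Qw
    where
    go : ∀ w → Acc _<_ w → Q w → ∃ λ m → Q m × (∀ z → Q z → ¬ z < m)
    go w (acc rs) Qw with any? (λ z → Q? z ×-dec (z <? w))
    ... | yes (z , Qz , z<w) = go z (rs z<w) Qz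
    ... | no ∄z              = w , Qw , λ z Qz z<w → ∄z (z , Qz , z<w)

module DynkinProperties {m : ℕ} (Γ : Dynkin m) where
  open Dynkin Γ

  ∼-sym : ∀ {a b} → a ∼ b → b ∼ a
  ∼-sym {a} {b} (a≢b , θab<0) =
    b≢a , ℤ.≤∧≢⇒< (θ-off b a b≢a) (λ θba≡0 → ℤ.<⇒≢ θab<0 (θ-zero b a θba≡0))
    where b≢a = λ b≡a → a≢b (sym b≡a)

  simplyLaced-∼⇒-θ≡1 : SimplyLaced Γ → ∀ {a b} → a ∼ b → - θ a b ≡ + 1
  simplyLaced-∼⇒-θ≡1 sl {a} {b} (_ , θab<0) with sl a b
  ... | inj₁ θab≡-1        rewrite θab≡-1 = refl
  ... | inj₂ (inj₁ θab≡0)  = contradiction θab≡0 (ℤ.<⇒≢ θab<0)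
  ... | inj₂ (inj₂ θab≡2)  = contradiction θab≡2 (ℤ.<⇒≢ (ℤ.<-trans θab<0 (ℤ.+<+ (ℕ.s≤s ℕ.z≤n))))

module ColoredPosetProperties {m : ℕ} {Γ : Dynkin m} (P : ColoredPoset Γ) where
  open Dynkin Γ
  open DynkinProperties Γ
  open ColoredPoset P
  private module PO = IsDecPartialOrder isDPO

  ≺-trans : ∀ {x y z} → x ≺ y → y ≺ z → x ≺ z
  ≺-trans (x≼y , _) (y≼z , y≢z) = PO.trans x≼y y≼z , λ { refl → y≢z (PO.antisym y≼z x≼y) }

  ≺-irrefl : ∀ {x} → ¬ x ≺ x
  ≺-irrefl (_ , x≢x) = x≢x refl

  ≺-wellFounded : WellFounded _≺_
  ≺-wellFounded = po-wellFounded PO.isPartialOrder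

  ≻-wellFounded : WellFounded (λ x y → y ≺ x)
  ≻-wellFounded = po-noetherian PO.isPartialOrder

  ≺⇒∃⋖≼ : ∀ {x y} → x ≺ y → ∃ λ u → x ⋖ u × u ≼ y
  ≺⇒∃⋖≼ {x} {y} x≺y
    with minimal _≺?_ ≺-wellFounded (λ u → (x ≺? u) ×-dec (u ≼? y)) (x≺y , PO.refl)
  ... | u , (x≺u , u≼y) , u-minimal =
    u , (x≺u , λ t x≺t t≺u → u-minimal t (x≺t , PO.trans (proj₁ t≺u) u≼y) t≺u) , u≼y

  InCh-≼ : ∀ {x y} → x ≼ y → InCh x → InCh y
  InCh-≼ x≼y chx z w y≼z y≼w = chx z w (PO.trans x≼y y≼z) (PO.trans x≼y y≼w)

  module _ (simplyLaced : SimplyLaced Γ) (dComplete : IsDComplete) where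
    open IsDComplete dComplete

    ⋖⇒∼ : ∀ {x y} → x ⋖ y → κ y ∼ κ x
    ⋖⇒∼ x⋖y = ∼-sym (NA _ _ x⋖y)

    MaxInColor⇒U-unique : ∀ {x y z} → MaxInColor x →
      x ≺ y → κ y ∼ κ x → x ≺ z → κ z ∼ κ x → y ≡ z
    MaxInColor⇒U-unique {x} {y} {z} max-x x≺y y∼x x≺z z∼x =
      filter-sum≤1⇒unique _ _ (λ Uy → simplyLaced-∼⇒-θ≡1 simplyLaced (proj₂ Uy))
        (UCB1 (κ x) x refl max-x) (∈-allFin y) (∈-allFin z) (x≺y , y∼x) (x≺z , z∼x)

    MaxInColor⇒U-MaxInColor : ∀ {x y} → MaxInColor x → x ≺ y → κ y ∼ κ x → MaxInColor y
    MaxInColor⇒U-MaxInColor max-x x≺y y∼x t κt≡κy y≺t =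
      ≺-irrefl (subst (_≺ t) (MaxInColor⇒U-unique max-x x≺y y∼x x≺t t∼x) y≺t)
      where
      x≺t = ≺-trans x≺y y≺t
      t∼x = subst (_∼ κ _) (sym κt≡κy) y∼x

    -- An element of U(x) strictly above another upper cover c of x would make c a
    -- second element of U(x).
    MaxInColor⇒U-⋖ : ∀ {x y} → MaxInColor x → x ≺ y → κ y ∼ κ x → x ⋖ y
    MaxInColor⇒U-⋖ {x} {y} max-x x≺y y∼x = x≺y , between
      where
      between : ∀ z → x ≺ z → ¬ z ≺ y
      between z x≺z z≺y with ≺⇒∃⋖≼ x≺z
      ... | c , x⋖c , c≼z with MaxInColor⇒U-unique max-x (proj₁ x⋖c) (⋖⇒∼ x⋖c) x≺y y∼x
      ... | refl = proj₂ z≺y (PO.antisym (proj₁ z≺y) c≼z)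

    InTopTree⇒InCh : ∀ x → InTopTree x → InCh x
    InTopTree⇒InCh = WF.All.wfRec ≻-wellFounded _ (λ x → InTopTree x → InCh x) step
      where
      step : ∀ x → (∀ {y} → x ≺ y → InTopTree y → InCh y) → InTopTree x → InCh x
      step x ih top-x y z x≼y x≼z with x ≟ y | x ≟ z
      ... | yes refl | _        = inj₁ x≼z
      ... | no _     | yes refl = inj₂ x≼y
      ... | no x≢y   | no x≢z
        with ≺⇒∃⋖≼ (x≼y , x≢y) | ≺⇒∃⋖≼ (x≼z , x≢z)
      ... | y₁ , x⋖y₁ , y₁≼y | z₁ , x⋖z₁ , z₁≼z
        with MaxInColor⇒U-unique top-x (proj₁ x⋖y₁) (⋖⇒∼ x⋖y₁) (proj₁ x⋖z₁) (⋖⇒∼ x⋖z₁)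
      ... | refl = ih (proj₁ x⋖y₁)
                      (MaxInColor⇒U-MaxInColor top-x (proj₁ x⋖y₁) (⋖⇒∼ x⋖y₁)) y z y₁≼y z₁≼z

    -- Any z in (u, v) is comparable with u₁ because the filter of u is a chain; it
    -- cannot lie below u₁, which covers u, nor above it, since v ∈ U(u₁) covers u₁.
    InCh⇒interval⊆cover : ∀ {u u₁ v z} → InCh u → (∀ {z} → u ≺ z → InTopTree z) →
      u ⋖ u₁ → κ v ∼ κ u₁ → u ≺ z → z ≺ v → z ≡ u₁
    InCh⇒interval⊆cover {u₁ = u₁} {z = z} ch-u above u⋖u₁ v∼u₁ u≺z z≺v
      with z ≟ u₁ | ch-u z u₁ (proj₁ u≺z) (proj₁ (proj₁ u⋖u₁))
    ... | yes z≡u₁ | _         = z≡u₁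
    ... | no z≢u₁  | inj₁ z≼u₁ = contradiction (z≼u₁ , z≢u₁) (proj₂ u⋖u₁ z u≺z)
    ... | no z≢u₁  | inj₂ u₁≼z = ⊥-elim (proj₂ u₁⋖v z u₁≺z z≺v)
      where
      u₁≺z = u₁≼z , λ u₁≡z → z≢u₁ (sym u₁≡z)
      u₁⋖v = MaxInColor⇒U-⋖ (above (proj₁ u⋖u₁)) (≺-trans u₁≺z z≺v) v∼u₁

    InCh∧≻-InTopTree⇒InTopTree : ∀ {u} → InCh u → (∀ {z} → u ≺ z → InTopTree z) →
      InTopTree u
    InCh∧≻-InTopTree⇒InTopTree {u} ch-u above t κt≡κu u≺t
      with minimal _≺?_ ≺-wellFounded (λ v → (κ v ≟ κ u) ×-dec (u ≺? v)) (κt≡κu , u≺t)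
    ... | v , (κv≡κu , u≺v) , v-minimal with ≺⇒∃⋖≼ u≺v
    ... | u₁ , u⋖u₁ , _ =
      intervalSum≢2 (filter-unique-sum (λ z → (u ≺? z) ×-dec (z ≺? v)) (λ z → - θ (κ z) (κ u))
                       u₁ (Unique.allFin⁺ n) interval⊆u₁)
      where
      u₁∼u : κ u₁ ∼ κ u
      u₁∼u = ⋖⇒∼ u⋖u₁

      interval⊆u₁ : ∀ {z} → u ≺ z × z ≺ v → z ≡ u₁
      interval⊆u₁ (u≺z , z≺v) = InCh⇒interval⊆cover ch-u above u⋖u₁
        (subst (_∼ κ u₁) (sym κv≡κu) (∼-sym u₁∼u)) u≺z z≺v

      ice2 : intervalSum (κ u) u v ≡ + 2
      ice2 = ICE2 (κ u) u v
        (refl , κv≡κu , u≺v , λ s u≺s s≺v κs≡κu → v-minimal s (κs≡κu , u≺s) s≺v)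

      intervalSum≢2 : (intervalSum (κ u) u v ≡ 0ℤ) ⊎ (intervalSum (κ u) u v ≡ - θ (κ u₁) (κ u)) → ⊥
      intervalSum≢2 (inj₁ sum≡0) = contradiction (trans (sym sum≡0) ice2) λ ()
      intervalSum≢2 (inj₂ sum≡θ) = contradiction
        (trans (sym (trans sum≡θ (simplyLaced-∼⇒-θ≡1 simplyLaced u₁∼u))) ice2) λ ()

    InCh⇒InTopTree : ∀ x → InCh x → InTopTree x
    InCh⇒InTopTree = WF.All.wfRec ≻-wellFounded _ (λ x → InCh x → InTopTree x) step
      where
      step : ∀ x → (∀ {y} → x ≺ y → InCh y → InTopTree y) → InCh x → InTopTree x
      step x ih ch-x = InCh∧≻-InTopTree⇒InTopTree ch-x
        (λ x≺z → ih x≺z (InCh-≼ (proj₁ x≺z) ch-x))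

lemma4p2 : ∀ {m : ℕ} (Γ : Dynkin m) → SimplyLaced Γ →
    (P : ColoredPoset Γ) → ColoredPoset.IsDComplete P →
    ∀ (x : Fin (ColoredPoset.n P)) →
      ColoredPoset.InTopTree P x ⇔ ColoredPoset.InCh P x
lemma4p2 Γ simplyLaced P dComplete x =
  mk⇔ (InTopTree⇒InCh P simplyLaced dComplete x) (InCh⇒InTopTree P simplyLaced dComplete x)
  where open ColoredPosetProperties
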